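{- Let $k\ge2$ be an integer and $f_k(x)=\min\{x,k\}$. For every input $I$, $C_k(\hat I)\le\frac32 O_k(I)+2.5$, where $O_k(I)$ and $C_k(\hat I)$ are the $f_k$-costs of the overflowed partition of $I$ and of the derived packing of $\hat I$ defined in the context.
   Context: Items $I=\{1,\dots,n\}$ with sizes $1\ge s_1\ge\dots\ge s_n\ge0$; the cost of a partition into bins with respect to $g$ is $\sum_{\text{bins }B}g(|B|)$. Large items are those of size in $(\frac12,1]$, $t$ is their number, small items are $t+1,\dots,n$. Algorithm MH (relevant part): with $w$ the weight function ($\pi_1=2$, $\pi_{i+1}=\pi_i(\pi_i-1)+1$; for $p\in(\frac1{k'+1},\frac1{k'}]$, $w(p)=\frac1{k'}$ if $k'=\pi_i-1$ for some $i$, else $w(p)=\frac{k'+1}{k'}p$; $w(0)=0$), MH matches small items to the large items $M_0=\{\lceil\frac{t+1}2\rceil,\dots,t\}$ greedily: queue of small items in order $t+1,t+2,\dots$, queue $M_0$ in order $t,t-1,\dots$; with heads $j$ (small) and $i$ (large), if $s_i+s_j\le1$ match and remove both, else remove $j$; stop when a queue is empty. (At most $\lceil t/2\rceil$ small items are matched.) $\hat I$ is obtained from $I$ by replacing every small item matched by MH by an item of size $s_1$. Overflowed partition of $I$: sort the items by non-decreasing size; repeatedly assign to the next bin a minimum prefix of the remaining items whose total size exceeds $1$ (the last bin receives whatever remains). $O_k(I)$ is its $f_k$-cost. Derived packing of $\hat I$: start from the overflowed partition of $I$, delete from it the small items matched by MH; for every bin whose total size still exceeds $1$, remove its last (largest)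 item and open a new bin containing only that item; finally, each of the items of $\hat I$ of size $s_1$ that replaced matched items is placed in its own dedicated bin. $C_k(\hat I)$ is the $f_k$-cost of this packing.
   Formalization: The item sizes are rational numbers. -}

module Defs where

open import Data.Bool using (Bool; true; false; if_then_else_; not; _∧_)
open import Data.Nat as ℕ using (ℕ; zero; suc; _⊓_; _/_)
open import Data.Fin as Fin using (Fin; toℕ)
open import Data.Product using (_×_; _,_; proj₁; proj₂)
open import Data.List using (List; []; _∷_; _++_; [_]; length; filter; take; drop;
  reverse; map; foldr; tabulate; concatMap)
open import Data.Bool.ListAction using (any)
open import Data.Nat.ListAction using (sum)
open import Data.Rational using (ℚ; 0ℚ; 1ℚ; ½; _+_; _≤ᵇ_; _≤_)
import Relation.Nullary.Decidable as Dec
open import Relation.Unary using (Pred)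

Item : Set
Item = ℕ × ℚ

size : Item → ℚ
size = proj₂

idx : Item → ℕ
idx = proj₁

_<ᵇ_ : ℚ → ℚ → Bool
p <ᵇ q = not (q ≤ᵇ p)

items : (n : ℕ) → (Fin n → ℚ) → List Item
items n s = tabulate (λ i → (suc (toℕ i) , s i))

total : List Item → ℚ
total = foldr (λ x acc → size x + acc) 0ℚ

numLarge : List Item → ℕ
numLarge xs = length (filter (λ x → Dec.T? (½ <ᵇ size x)) xs)

-- Greedy MH matching. First argument: queue of large items of M₀,
-- second: queue of small items. Returns the matched small items.
mhMatch : List Item → List Item → List Item
mhMatch []       _        = []
mhMatch (_ ∷ _)  []       = []
mhMatch (i ∷ is) (j ∷ js) =
  if (size i + size j) ≤ᵇ 1ℚ then j ∷ mhMatch is js else mhMatch (i ∷ is) js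

-- M₀ = {⌈(t+1)/2⌉, …, t} in queue order t, t-1, …;
-- note ⌈(t+1)/2⌉ = ⌊t/2⌋ + 1, so M₀ (1-based) = items ⌊t/2⌋+1 … t.
M₀queue : List Item → List Item
M₀queue xs = let t = numLarge xs in reverse (drop (t / 2) (take t xs))

smallQueue : List Item → List Item
smallQueue xs = drop (numLarge xs) xs

matched : List Item → List Item
matched xs = mhMatch (M₀queue xs) (smallQueue xs)

isMatched : List Item → Item → Bool
isMatched xs y = any (λ z → Dec.⌊ idx z ℕ.≟ idx y ⌋) (matched xs)

-- Overflowed partition of an already non-decreasingly sorted list:
-- cur = current (open) bin, acc = its total size.
overflowGo : List Item → List Item → ℚ → List (List Item)
overflowGo []       []        _   = []
overflowGo []       (c ∷ cs)  _   = [ c ∷ cs ]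
overflowGo (x ∷ xs) cur       acc =
  if 1ℚ <ᵇ (acc + size x)
    then (cur ++ [ x ]) ∷ overflowGo xs [] 0ℚ
    else overflowGo xs (cur ++ [ x ]) (acc + size x)

-- Sorting by non-decreasing size: the input is non-increasing in index order,
-- so we take the items in order n, n-1, …, 1.
overflowed : List Item → List (List Item)
overflowed xs = overflowGo (reverse xs) [] 0ℚ

fk : ℕ → ℕ → ℕ
fk k x = x ⊓ k

cost : ℕ → List (List Item) → ℕ
cost k bins = sum (map (λ B → fk k (length B)) bins)

splitLast : List Item → List Item × List Item
splitLast []       = [] , []
splitLast (x ∷ []) = [] , [ x ]
splitLast (x ∷ y ∷ ys) with splitLast (y ∷ ys)
... | (a , b) = (x ∷ a , b)

-- after deleting matched items from a bin: if total > 1, remove the last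
-- (largest) item and put it in a new bin
fixBin : List Item → List (List Item)
fixBin B = if 1ℚ <ᵇ total B
             then (proj₁ (splitLast B) ∷ proj₂ (splitLast B) ∷ [])
             else [ B ]

-- s₁ (first/largest size); default irrelevant when there are no items
firstSize : List Item → ℚ
firstSize []      = 0ℚ
firstSize (x ∷ _) = size x

derived : List Item → List (List Item)
derived xs =
  concatMap (λ B → fixBin (filter (λ y → Dec.T? (not (isMatched xs y))) B)) (overflowed xs)
  ++ map (λ j → [ (idx j , firstSize xs) ]) (matched xs)

Ok : ℕ → List Item → ℕ
Ok k xs = cost k (overflowed xs)

Ck : ℕ → List Item → ℕ
Ck k xs = cost k (derived xs)

ValidInput : (n : ℕ) → (Fin n → ℚ) → Set
ValidInput n s =
  ((i : Fin n) → (0ℚ ≤ s i) × (s i ≤ 1ℚ)) ×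
  ((i j : Fin n) → i Fin.≤ j → s j ≤ s i)

-- Let t be the number of large items. MH matches at most ⌈t/2⌉ small items, and each costs 1
-- in the derived packing, so twice their cost is at most t + 1. The open bin of the overflowed
-- partition has total at most 1 and hence at most one large item, so every bin B holds L ≤ 2 large
-- items. Deleting items from B and splitting off the last one raises the f_k-cost above f_k(|B|)
-- only if |B| > k, and then by one; a case analysis gives
--   2 · cost(repacked B) + L ≤ 3 f_k(|B|) + 2 · [B contains both large and small items].
-- The overflowed partition takes the items by increasing size, so at most one bin is mixed, and
-- summing over the bins gives 2 C_k ≤ 3 O_k + 3.
module Submission where

open import Defs
open import Data.Nat using (ℕ; _≤_; _+_; _*_; zero; suc; _∸_; _⊓_; _<_; z≤n; s≤s)
open import Data.Fin as Fin using (Fin)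
open import Data.Rational using (ℚ)

open import Data.Bool using (true; false; not; T)
open import Data.Empty using (⊥-elim)
open import Data.List using (List; []; _∷_; _++_; [_]; length; filter; take; drop;
  reverse; map; concat; concatMap)
import Data.List.Properties as List
open import Data.List.Relation.Unary.All as All using (All; []; _∷_)
import Data.List.Relation.Unary.All.Properties as All
import Data.List.Relation.Unary.Any.Properties as Any
open import Data.List.Relation.Unary.AllPairs as AllPairs using (AllPairs; []; _∷_)
import Data.List.Relation.Unary.AllPairs.Properties as AllPairs
open import Data.Nat.DivMod using (_/_; _%_; m≡m%n+[m/n]*n; m%n<n)
open import Data.Nat.ListAction using (sum)
open import Data.Nat.ListAction.Properties using (sum-++)
open import Data.Nat.Properties hiding (<ᵇ⇒<; <⇒<ᵇ)
open import Data.Nat.Solver using (module +-*-Solver)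
open import Data.Product as Product using (_×_; _,_; proj₁; proj₂)
open import Data.Rational as ℚ using (0ℚ; 1ℚ; ½; _≤ᵇ_)
import Data.Rational.Properties as ℚ
open import Data.Sum as Sum using (_⊎_; inj₁; inj₂)
open import Data.Unit using (tt)
open import Function using (_∘_; flip)
open import Relation.Binary using (Rel)
open import Relation.Binary.PropositionalEquality
  using (_≡_; refl; sym; trans; cong; cong₂; subst; module ≡-Reasoning)
open import Relation.Nullary using (yes; no)
open import Relation.Nullary.Decidable using (T?)
open import Relation.Unary using (Pred; Decidable; ∁)
open import Relation.Unary.Properties using (∁?)

open +-*-Solver using (solve; _:+_; _:*_; _:=_; con)

All-reverse : ∀ {a p} {A : Set a} {P : Pred A p} {xs} → All P xs → All P (reverse xs)
All-reverse pxs = All.tabulate (λ x∈ → All.lookup pxs (Any.reverse⁻ x∈))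

AllPairs-reverse : ∀ {a r} {A : Set a} {R : Rel A r} {xs} →
                   AllPairs R xs → AllPairs (flip R) (reverse xs)
AllPairs-reverse [] = []
AllPairs-reverse {R = R} {x ∷ xs} (Rx ∷ pxs) =
  subst (AllPairs (flip R)) (sym (List.unfold-reverse x xs))
        (AllPairs.++⁺ (AllPairs-reverse pxs) ([] ∷ []) (All.map (_∷ []) (All-reverse Rx)))

AllPairs-++⁻ʳ : ∀ {a r} {A : Set a} {R : Rel A r} xs {ys} → AllPairs R (xs ++ ys) → AllPairs R ys
AllPairs-++⁻ʳ []       pys        = pys
AllPairs-++⁻ʳ (x ∷ xs) (_ ∷ pxys) = AllPairs-++⁻ʳ xs pxys

<ᵇ⇒< : ∀ {p q} → T (p <ᵇ q) → p ℚ.< q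
<ᵇ⇒< {p} {q} h with q ≤ᵇ p in eq
... | false = ℚ.≰⇒> (λ q≤p → subst T eq (ℚ.≤⇒≤ᵇ q≤p))

<⇒<ᵇ : ∀ {p q} → p ℚ.< q → T (p <ᵇ q)
<⇒<ᵇ {p} {q} p<q with q ≤ᵇ p in eq
... | true  = ℚ.<-irrefl refl (ℚ.<-≤-trans p<q (ℚ.≤ᵇ⇒≤ (subst T (sym eq) tt)))
... | false = tt

<ᵇ≡false⇒≥ : ∀ {p q} → (p <ᵇ q) ≡ false → q ℚ.≤ p
<ᵇ≡false⇒≥ {p} {q} h with q ≤ᵇ p in eq
... | true = ℚ.≤ᵇ⇒≤ (subst T (sym eq) tt)

Large : Pred Item _
Large x = T (½ <ᵇ size x)

large? : Decidable Large
large? x = T? (½ <ᵇ size x)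

Large-mono : ∀ {x y} → size x ℚ.≤ size y → Large x → Large y
Large-mono {x} {y} x≤y lx = <⇒<ᵇ {½} {size y} (ℚ.<-≤-trans (<ᵇ⇒< {½} {size x} lx) x≤y)

numSmall : List Item → ℕ
numSmall xs = length (filter (∁? large?) xs)

length≡numLarge+numSmall : ∀ xs → length xs ≡ numLarge xs + numSmall xs
length≡numLarge+numSmall [] = refl
length≡numLarge+numSmall (x ∷ xs) with ½ <ᵇ size x
... | true  = cong suc (length≡numLarge+numSmall xs)
... | false = trans (cong suc (length≡numLarge+numSmall xs)) (sym (+-suc _ _))

numLarge-++ : ∀ xs ys → numLarge (xs ++ ys) ≡ numLarge xs + numLarge ys
numLarge-++ xs ys = trans (cong length (List.filter-++ large? xs ys)) (List.length-++ (filter large? xs))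

numLarge-reverse : ∀ xs → numLarge (reverse xs) ≡ numLarge xs
numLarge-reverse [] = refl
numLarge-reverse (x ∷ xs) = begin
  numLarge (reverse (x ∷ xs))         ≡⟨ cong numLarge (List.unfold-reverse x xs) ⟩
  numLarge (reverse xs ++ [ x ])      ≡⟨ numLarge-++ (reverse xs) [ x ] ⟩
  numLarge (reverse xs) + numLarge [ x ] ≡⟨ cong (_+ numLarge [ x ]) (numLarge-reverse xs) ⟩
  numLarge xs + numLarge [ x ]        ≡⟨ +-comm (numLarge xs) _ ⟩
  numLarge [ x ] + numLarge xs        ≡⟨ numLarge-++ [ x ] xs ⟨
  numLarge (x ∷ xs)                   ∎
  where open ≡-Reasoning

numLarge-concat : ∀ bins → numLarge (concat bins) ≡ sum (map numLarge bins)
numLarge-concat [] = refl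
numLarge-concat (B ∷ bins) =
  trans (numLarge-++ B (concat bins)) (cong (numLarge B +_) (numLarge-concat bins))

cost-++ : ∀ k bins bins′ → cost k (bins ++ bins′) ≡ cost k bins + cost k bins′
cost-++ k bins bins′ =
  trans (cong sum (List.map-++ (λ B → fk k (length B)) bins bins′))
        (sum-++ (map (λ B → fk k (length B)) bins) _)

cost-singletons : ∀ k → 1 ≤ k → {A : Set} (h : A → Item) (xs : List A) →
                  cost k (map (λ x → [ h x ]) xs) ≡ length xs
cost-singletons (suc k) _ h [] = refl
cost-singletons (suc k) k≥1 h (x ∷ xs) = cong suc (cost-singletons (suc k) k≥1 h xs)

overflowGo-concat : ∀ ys cur acc → concat (overflowGo ys cur acc) ≡ cur ++ ys
overflowGo-concat [] [] _ = refl
overflowGo-concat [] (c ∷ cs) _ = refl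
overflowGo-concat (x ∷ ys) cur acc with 1ℚ <ᵇ (acc ℚ.+ size x)
... | true  = trans (cong ((cur ++ [ x ]) ++_) (overflowGo-concat ys [] 0ℚ)) (List.++-assoc cur [ x ] ys)
... | false = trans (overflowGo-concat ys (cur ++ [ x ]) (acc ℚ.+ size x)) (List.++-assoc cur [ x ] ys)

concat-overflowed : ∀ xs → concat (overflowed xs) ≡ reverse xs
concat-overflowed xs = overflowGo-concat (reverse xs) [] 0ℚ

AtMostOneLarge : List Item → ℚ → Set
AtMostOneLarge cur acc = numLarge cur ≡ 0 ⊎ (numLarge cur ≡ 1 × ½ ℚ.< acc)

OpenBin : List Item → ℚ → Set
OpenBin cur acc = 0ℚ ℚ.≤ acc × AtMostOneLarge cur acc

numLarge-∷ʳ : ∀ cur x →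
  numLarge (cur ++ [ x ]) ≡ numLarge cur ⊎ (Large x × numLarge (cur ++ [ x ]) ≡ suc (numLarge cur))
numLarge-∷ʳ cur x with large? x
... | yes large = inj₂ (large , trans (numLarge-++ cur [ x ])
  (trans (cong (λ ys → numLarge cur + length ys) (List.filter-accept large? {x} {[]} large))
         (+-comm (numLarge cur) 1)))
... | no small  = inj₁ (trans (numLarge-++ cur [ x ])
  (trans (cong (λ ys → numLarge cur + length ys) (List.filter-reject large? {x} {[]} small))
         (+-identityʳ _)))

-- Two large items never share an open bin, since ½ + ½ = 1.
openBin-extend : ∀ {cur acc} x → OpenBin cur acc → 0ℚ ℚ.≤ size x →
                 acc ℚ.+ size x ℚ.≤ 1ℚ → OpenBin (cur ++ [ x ]) (acc ℚ.+ size x)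
openBin-extend {cur} {acc} x (acc≥0 , count) x≥0 fits =
  ℚ.+-mono-≤ acc≥0 x≥0 , count′ (numLarge-∷ʳ cur x) count
  where
  count′ : numLarge (cur ++ [ x ]) ≡ numLarge cur
           ⊎ (Large x × numLarge (cur ++ [ x ]) ≡ suc (numLarge cur)) →
           AtMostOneLarge cur acc → AtMostOneLarge (cur ++ [ x ]) (acc ℚ.+ size x)
  count′ (inj₁ same) (inj₁ none) = inj₁ (trans same none)
  count′ (inj₁ same) (inj₂ (one , ½<acc)) = inj₂ (trans same one , ℚ.+-mono-<-≤ ½<acc x≥0)
  count′ (inj₂ (large , more)) (inj₁ none) =
    inj₂ (trans more (cong suc none) , ℚ.+-mono-≤-< acc≥0 (<ᵇ⇒< {½} {size x} large))
  count′ (inj₂ (large , _)) (inj₂ (_ , ½<acc)) =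
    ⊥-elim (ℚ.<-irrefl refl (ℚ.<-≤-trans (ℚ.+-mono-< ½<acc (<ᵇ⇒< {½} {size x} large)) fits))

atMostOneLarge⇒≤1 : ∀ {cur acc} → AtMostOneLarge cur acc → numLarge cur ≤ 1
atMostOneLarge⇒≤1 (inj₁ none) = ≤-trans (≤-reflexive none) z≤n
atMostOneLarge⇒≤1 (inj₂ (one , _)) = ≤-reflexive one

overflowGo-numLarge≤2 : ∀ ys cur acc → All (λ x → 0ℚ ℚ.≤ size x) ys → OpenBin cur acc →
                        All (λ B → numLarge B ≤ 2) (overflowGo ys cur acc)
overflowGo-numLarge≤2 [] [] _ _ _ = []
overflowGo-numLarge≤2 [] (c ∷ cs) _ _ (_ , count) =
  m≤n⇒m≤1+n (atMostOneLarge⇒≤1 {c ∷ cs} count) ∷ []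
overflowGo-numLarge≤2 (x ∷ ys) cur acc (x≥0 ∷ ys≥0) bin@(_ , count) with 1ℚ <ᵇ (acc ℚ.+ size x) in eq
... | true  = closed ∷ overflowGo-numLarge≤2 ys [] 0ℚ ys≥0 (ℚ.≤-refl , inj₁ refl)
  where
  closed : numLarge (cur ++ [ x ]) ≤ 2
  closed = ≤-trans (≤-reflexive (numLarge-++ cur [ x ]))
                   (+-mono-≤ (atMostOneLarge⇒≤1 {cur} count) (List.length-filter large? [ x ]))
... | false = overflowGo-numLarge≤2 ys (cur ++ [ x ]) (acc ℚ.+ size x) ys≥0
                (openBin-extend {cur} x bin x≥0 (<ᵇ≡false⇒≥ {1ℚ} eq))

fk-mono : ∀ k {a b} → a ≤ b → fk k a ≤ fk k b
fk-mono k = ⊓-monoˡ-≤ k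

fk-split : ∀ k a → fk k a + fk k 1 ≤ fk k (suc a) ⊎ (k < suc a × fk k a + fk k 1 ≤ suc k)
fk-split k a with a <? k
... | yes a<k = inj₁ (begin
  fk k a + fk k 1 ≤⟨ +-monoʳ-≤ (fk k a) (m⊓n≤m 1 k) ⟩
  fk k a + 1      ≡⟨ cong (_+ 1) (m≤n⇒m⊓n≡m (<⇒≤ a<k)) ⟩
  a + 1           ≡⟨ +-comm a 1 ⟩
  suc a           ≡⟨ m≤n⇒m⊓n≡m a<k ⟨
  fk k (suc a)    ∎)
  where open ≤-Reasoning
... | no a≮k = inj₂ (s≤s (≮⇒≥ a≮k) ,
  ≤-trans (+-mono-≤ (m⊓n≤n a k) (m⊓n≤m 1 k)) (≤-reflexive (+-comm k 1)))

splitLast-lengths : ∀ x xs → length (proj₁ (splitLast (x ∷ xs))) ≡ length xs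
                           × length (proj₂ (splitLast (x ∷ xs))) ≡ 1
splitLast-lengths x [] = refl , refl
splitLast-lengths x (y ∷ ys) with splitLast (y ∷ ys) | splitLast-lengths y ys
... | _ , _ | init≡ , last≡ = cong suc init≡ , last≡

fixBin-cost : ∀ k B → All (λ x → size x ℚ.≤ 1ℚ) B →
  cost k (fixBin B) ≤ fk k (length B) ⊎ (k < length B × cost k (fixBin B) ≤ suc k)
fixBin-cost k B B≤1 with 1ℚ <ᵇ total B in eq
... | false = inj₁ (≤-reflexive (+-identityʳ _))
fixBin-cost k (x ∷ []) (x≤1 ∷ []) | true =
  ⊥-elim (ℚ.<-irrefl refl (ℚ.<-≤-trans (<ᵇ⇒< {1ℚ} (subst T (sym eq) tt))
                                        (ℚ.≤-trans (ℚ.≤-reflexive (ℚ.+-identityʳ (size x))) x≤1)))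
fixBin-cost k (x ∷ y ∷ ys) _ | true with splitLast-lengths x (y ∷ ys)
... | init≡ , last≡ =
  subst (λ c → c ≤ fk k (length (x ∷ y ∷ ys)) ⊎ (k < length (x ∷ y ∷ ys) × c ≤ suc k))
        (sym (trans (cong₂ (λ a b → fk k a + (fk k b + 0)) init≡ last≡)
                    (cong (fk k (length (y ∷ ys)) +_) (+-identityʳ _))))
        (fk-split k (length (y ∷ ys)))

positiveBoth : ℕ → ℕ → ℕ
positiveBoth (suc _) (suc _) = 1
positiveBoth _       _       = 0

positiveBoth≤1 : ∀ m n → positiveBoth m n ≤ 1
positiveBoth≤1 zero    n       = z≤n
positiveBoth≤1 (suc m) zero    = z≤n
positiveBoth≤1 (suc m) (suc n) = ≤-refl

positiveBoth-zeroʳ : ∀ m → positiveBoth m 0 ≡ 0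
positiveBoth-zeroʳ zero    = refl
positiveBoth-zeroʳ (suc m) = refl

≤2*positiveBoth : ∀ L S → L ≤ 2 → L ≤ 2 * positiveBoth L (suc S)
≤2*positiveBoth zero    S _   = z≤n
≤2*positiveBoth (suc L) S L≤2 = L≤2

≤fk+2*positiveBoth : ∀ {k} L S → 2 ≤ k → L ≤ 2 → L ≤ fk k (L + S) + 2 * positiveBoth L S
≤fk+2*positiveBoth {k} L zero k≥2 L≤2 = begin
  L          ≡⟨ m≤n⇒m⊓n≡m (≤-trans L≤2 k≥2) ⟨
  L ⊓ k      ≡⟨ cong (_⊓ k) (+-identityʳ L) ⟨
  fk k (L + 0) ≤⟨ m≤m+n _ _ ⟩
  fk k (L + 0) + 2 * positiveBoth L 0 ∎
  where open ≤-Reasoning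
≤fk+2*positiveBoth {k} L (suc S) k≥2 L≤2 =
  ≤-trans (≤2*positiveBoth L S L≤2) (m≤n+m _ (fk k (L + suc S)))

bin-inequality : ∀ {k c} L S → 2 ≤ k → L ≤ 2 →
  c ≤ fk k (L + S) ⊎ (k < L + S × c ≤ suc k) →
  2 * c + L ≤ 3 * fk k (L + S) + 2 * positiveBoth L S
bin-inequality {k} {c} L S k≥2 L≤2 (inj₁ c≤F) = begin
  2 * c + L       ≤⟨ +-mono-≤ (*-monoʳ-≤ 2 c≤F) (≤fk+2*positiveBoth L S k≥2 L≤2) ⟩
  2 * F + (F + m) ≡⟨ +-assoc (2 * F) F m ⟨
  2 * F + F + m   ≡⟨ cong (_+ m) (+-comm (2 * F) F) ⟩
  3 * F + m       ∎
  where
  open ≤-Reasoning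
  F = fk k (L + S)
  m = 2 * positiveBoth L S
bin-inequality {k} L zero k≥2 L≤2 (inj₂ (k<L+0 , _)) =
  ⊥-elim (<⇒≱ k<L+0 (≤-trans (≤-reflexive (+-identityʳ L)) (≤-trans L≤2 k≥2)))
bin-inequality {k} {c} L (suc S) k≥2 L≤2 (inj₂ (k<ℓ , c≤1+k)) = begin
  2 * c + L                  ≤⟨ +-mono-≤ (*-monoʳ-≤ 2 c≤1+k) (≤2*positiveBoth L S L≤2) ⟩
  2 * suc k + m              ≡⟨ cong (_+ m) (*-suc 2 k) ⟩
  2 + 2 * k + m              ≤⟨ +-monoˡ-≤ m (+-monoˡ-≤ (2 * k) k≥2) ⟩
  3 * k + m                  ≡⟨ cong (λ F → 3 * F + m) (m≥n⇒m⊓n≡n (<⇒≤ k<ℓ)) ⟨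
  3 * fk k (L + suc S) + m   ∎
  where
  open ≤-Reasoning
  m = 2 * positiveBoth L (suc S)

mixed : List Item → ℕ
mixed B = positiveBoth (numLarge B) (numSmall B)

module _ {p} {P : Pred Item p} (P? : Decidable P) {k : ℕ} (k≥2 : 2 ≤ k) where

  bin-bound : ∀ B → numLarge B ≤ 2 → All (λ x → size x ℚ.≤ 1ℚ) B →
    2 * cost k (fixBin (filter P? B)) + numLarge B ≤ 3 * fk k (length B) + 2 * mixed B
  bin-bound B L≤2 B≤1 =
    subst (λ ℓ → 2 * cost k (fixBin (filter P? B)) + numLarge B ≤ 3 * fk k ℓ + 2 * mixed B)
          (sym (length≡numLarge+numSmall B))
          (bin-inequality (numLarge B) (numSmall B) k≥2 L≤2
            (Sum.map (λ c≤ → ≤-trans c≤ (fk-mono k kept≤))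
                     (Product.map₁ (λ k< → <-≤-trans k< kept≤))
                     (fixBin-cost k (filter P? B) (All.filter⁺ P? B≤1))))
    where
    kept≤ : length (filter P? B) ≤ numLarge B + numSmall B
    kept≤ = ≤-trans (List.length-filter P? B) (≤-reflexive (length≡numLarge+numSmall B))

  repack-bound : ∀ bins → All (λ B → numLarge B ≤ 2) bins →
    All (All (λ x → size x ℚ.≤ 1ℚ)) bins →
    2 * cost k (concatMap (fixBin ∘ filter P?) bins) + sum (map numLarge bins)
      ≤ 3 * cost k bins + 2 * sum (map mixed bins)
  repack-bound [] [] [] = z≤n
  repack-bound (B ∷ bins) (L≤2 ∷ Ls≤2) (B≤1 ∷ bins≤1) = begin
    2 * cost k (fixBin (filter P? B) ++ concatMap (fixBin ∘ filter P?) bins) + (numLarge B + L)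
      ≡⟨ cong (λ c → 2 * c + (numLarge B + L)) (cost-++ k (fixBin (filter P? B)) _) ⟩
    2 * (c + C) + (numLarge B + L)            ≡⟨ regroup c C (numLarge B) L ⟩
    (2 * c + numLarge B) + (2 * C + L)
      ≤⟨ +-mono-≤ (bin-bound B L≤2 B≤1) (repack-bound bins Ls≤2 bins≤1) ⟩
    (3 * f + 2 * m) + (3 * F + 2 * M)         ≡⟨ collect f F m M ⟩
    3 * (f + F) + 2 * (m + M)                 ∎
    where
    open ≤-Reasoning
    c = cost k (fixBin (filter P? B))
    C = cost k (concatMap (fixBin ∘ filter P?) bins)
    L = sum (map numLarge bins)
    f = fk k (length B)
    F = cost k bins
    m = mixed B
    M = sum (map mixed bins)
    regroup : ∀ c C l L → 2 * (c + C) + (l + L) ≡ (2 * c + l) + (2 * C + L)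
    regroup = solve 4 (λ c C l L → con 2 :* (c :+ C) :+ (l :+ L) := (con 2 :* c :+ l) :+ (con 2 :* C :+ L)) refl
    collect : ∀ f F m M → (3 * f + 2 * m) + (3 * F + 2 * M) ≡ 3 * (f + F) + 2 * (m + M)
    collect = solve 4 (λ f F m M → (con 3 :* f :+ con 2 :* m) :+ (con 3 :* F :+ con 2 :* M)
                                 := con 3 :* (f :+ F) :+ con 2 :* (m :+ M)) refl

LargeUpward : List Item → Set
LargeUpward = AllPairs (λ x y → Large x → Large y)

small-or-large : ∀ xs {ys} → LargeUpward (xs ++ ys) → All (∁ Large) xs ⊎ All Large ys
small-or-large []       _               = inj₁ []
small-or-large (x ∷ xs) (x↑ ∷ upward) with large? x
... | yes lx  = inj₂ (All.map (λ x↑y → x↑y lx) (All.++⁻ʳ xs x↑))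
... | no  ¬lx = Sum.map₁ (¬lx ∷_) (small-or-large xs upward)

mixed-allSmall : ∀ {B} → All (∁ Large) B → mixed B ≡ 0
mixed-allSmall {B} small = cong (λ ls → positiveBoth (length ls) (numSmall B)) (List.filter-none large? small)

mixed-allLarge : ∀ {B} → All Large B → mixed B ≡ 0
mixed-allLarge {B} large =
  trans (cong (λ ss → positiveBoth (numLarge B) (length ss))
              (List.filter-none (∁? large?) (All.map (λ lx ¬lx → ¬lx lx) large)))
        (positiveBoth-zeroʳ (numLarge B))

sum-mixed-allLarge : ∀ bins → All Large (concat bins) → sum (map mixed bins) ≡ 0
sum-mixed-allLarge [] _ = refl
sum-mixed-allLarge (B ∷ bins) large =
  cong₂ _+_ (mixed-allLarge (All.++⁻ˡ B large)) (sum-mixed-allLarge bins (All.++⁻ʳ B large))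

-- Only the bin in which small items give way to large ones can be mixed.
sum-mixed≤1 : ∀ bins → LargeUpward (concat bins) → sum (map mixed bins) ≤ 1
sum-mixed≤1 []         _      = z≤n
sum-mixed≤1 (B ∷ bins) upward with small-or-large B upward
... | inj₁ small = subst (λ m → m + sum (map mixed bins) ≤ 1) (sym (mixed-allSmall small))
                         (sum-mixed≤1 bins (AllPairs-++⁻ʳ B upward))
... | inj₂ large = subst (λ M → mixed B + M ≤ 1) (sym (sum-mixed-allLarge bins large))
                         (≤-trans (≤-reflexive (+-identityʳ (mixed B))) (positiveBoth≤1 _ _))

mhMatch-length : ∀ larges smalls → length (mhMatch larges smalls) ≤ length larges
mhMatch-length []       _        = z≤n
mhMatch-length (i ∷ is) []       = z≤n
mhMatch-length (i ∷ is) (j ∷ js) with (size i ℚ.+ size j) ≤ᵇ 1ℚ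
... | true  = s≤s (mhMatch-length is js)
... | false = mhMatch-length (i ∷ is) js

2*[m∸m/2]≤1+m : ∀ m → 2 * (m ∸ m / 2) ≤ suc m
2*[m∸m/2]≤1+m m = subst (λ t → 2 * (t ∸ m / 2) ≤ suc t) (sym (m≡m%n+[m/n]*n m 2))
                        (bound (m % 2) (m / 2) (≤-pred (m%n<n m 2)))
  where
  open ≤-Reasoning
  bound : ∀ r q → r ≤ 1 → 2 * (r + q * 2 ∸ q) ≤ suc (r + q * 2)
  bound r q r≤1 = begin
    2 * (r + q * 2 ∸ q)   ≡⟨ cong (λ t → 2 * (t ∸ q))
                                  (solve 2 (λ r q → r :+ q :* con 2 := (r :+ q) :+ q) refl r q) ⟩
    2 * (r + q + q ∸ q)   ≡⟨ cong (2 *_) (m+n∸n≡m (r + q) q) ⟩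
    2 * (r + q)           ≡⟨ solve 2 (λ r q → con 2 :* (r :+ q) := r :+ (r :+ q :* con 2)) refl r q ⟩
    r + (r + q * 2)       ≤⟨ +-monoˡ-≤ (r + q * 2) r≤1 ⟩
    suc (r + q * 2)       ∎

matched-length : ∀ xs → 2 * length (matched xs) ≤ suc (numLarge xs)
matched-length xs = ≤-trans (*-monoʳ-≤ 2 (≤-trans (mhMatch-length (M₀queue xs) (smallQueue xs)) M₀≤))
                            (2*[m∸m/2]≤1+m t)
  where
  open ≤-Reasoning
  t = numLarge xs
  length-take≤ : length (take t xs) ≤ t
  length-take≤ = ≤-trans (≤-reflexive (List.length-take t xs)) (m⊓n≤m t _)
  M₀≤ : length (M₀queue xs) ≤ t ∸ t / 2
  M₀≤ = begin
    length (reverse (drop (t / 2) (take t xs))) ≡⟨ List.length-reverse (drop (t / 2) (take t xs)) ⟩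
    length (drop (t / 2) (take t xs))           ≡⟨ List.length-drop (t / 2) (take t xs) ⟩
    length (take t xs) ∸ t / 2                  ≤⟨ ∸-monoˡ-≤ (t / 2) length-take≤ ⟩
    t ∸ t / 2                                   ∎

overflowed-numLarge≤2 : ∀ xs → All (λ x → 0ℚ ℚ.≤ size x) xs →
                        All (λ B → numLarge B ≤ 2) (overflowed xs)
overflowed-numLarge≤2 xs xs≥0 =
  overflowGo-numLarge≤2 (reverse xs) [] 0ℚ (All-reverse xs≥0) (ℚ.≤-refl , inj₁ refl)

overflowed-items≤1 : ∀ xs → All (λ x → size x ℚ.≤ 1ℚ) xs →
                     All (All (λ x → size x ℚ.≤ 1ℚ)) (overflowed xs)
overflowed-items≤1 xs xs≤1 = All.concat⁻ (subst (All _) (sym (concat-overflowed xs)) (All-reverse xs≤1))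

sum-numLarge-overflowed : ∀ xs → sum (map numLarge (overflowed xs)) ≡ numLarge xs
sum-numLarge-overflowed xs = begin
  sum (map numLarge (overflowed xs)) ≡⟨ numLarge-concat (overflowed xs) ⟨
  numLarge (concat (overflowed xs))  ≡⟨ cong numLarge (concat-overflowed xs) ⟩
  numLarge (reverse xs)              ≡⟨ numLarge-reverse xs ⟩
  numLarge xs                        ∎
  where open ≡-Reasoning

overflowed-largeUpward : ∀ xs → AllPairs (λ x y → size y ℚ.≤ size x) xs →
                         LargeUpward (concat (overflowed xs))
overflowed-largeUpward xs sorted =
  subst LargeUpward (sym (concat-overflowed xs))
        (AllPairs.map (λ {x} {y} → Large-mono {x} {y}) (AllPairs-reverse sorted))

Ck≡repacked+matched : ∀ k → 1 ≤ k → ∀ xs →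
  Ck k xs ≡ cost k (concatMap (fixBin ∘ filter (λ y → T? (not (isMatched xs y)))) (overflowed xs))
            + length (matched xs)
Ck≡repacked+matched k k≥1 xs =
  trans (cost-++ k repacked _)
        (cong (cost k repacked +_) (cost-singletons k k≥1 (λ j → idx j , firstSize xs) (matched xs)))
  where
  repacked = concatMap (fixBin ∘ filter (λ y → T? (not (isMatched xs y)))) (overflowed xs)

items-sorted : ∀ n (s : Fin n → ℚ) → (∀ i j → i Fin.≤ j → s j ℚ.≤ s i) →
               AllPairs (λ x y → size y ℚ.≤ size x) (items n s)
items-sorted n s nonIncreasing = AllPairs.tabulate⁺-< (λ i<j → nonIncreasing _ _ (<⇒≤ i<j))

lemma7 : (k : ℕ) → 2 ≤ k → (n : ℕ) → (s : Fin n → ℚ) → ValidInput n s →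
             2 * Ck k (items n s) ≤ 3 * Ok k (items n s) + 5
lemma7 k k≥2 n s (bounded , nonIncreasing) = begin
  2 * Ck k xs                              ≡⟨ cong (2 *_) (Ck≡repacked+matched k k≥1 xs) ⟩
  2 * (X + length (matched xs))            ≡⟨ *-distribˡ-+ 2 X _ ⟩
  2 * X + 2 * length (matched xs)          ≤⟨ +-monoʳ-≤ (2 * X) (matched-length xs) ⟩
  2 * X + suc (numLarge xs)                ≡⟨ +-suc (2 * X) _ ⟩
  suc (2 * X + numLarge xs)                ≡⟨ cong (λ t → suc (2 * X + t)) (sum-numLarge-overflowed xs) ⟨
  suc (2 * X + sum (map numLarge bins))    ≤⟨ s≤s (repack-bound unmatched? k≥2 bins
                                                    (overflowed-numLarge≤2 xs (All.map proj₁ sizes))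
                                                    (overflowed-items≤1 xs (All.map proj₂ sizes))) ⟩
  suc (3 * O + 2 * sum (map mixed bins))   ≤⟨ s≤s (+-monoʳ-≤ (3 * O) (*-monoʳ-≤ 2
                                                 (sum-mixed≤1 bins (overflowed-largeUpward xs
                                                   (items-sorted n s nonIncreasing))))) ⟩
  suc (3 * O + 2)                          ≡⟨ +-suc (3 * O) 2 ⟨
  3 * O + 3                                ≤⟨ +-monoʳ-≤ (3 * O) (m≤m+n 3 2) ⟩
  3 * O + 5                                ∎
  where
  open ≤-Reasoning
  k≥1 = ≤-trans (s≤s z≤n) k≥2
  xs = items n s
  bins = overflowed xs
  O = Ok k xs
  unmatched? = λ y → T? (not (isMatched xs y))
  X = cost k (concatMap (fixBin ∘ filter unmatched?) bins)
  sizes : All (λ x → 0ℚ ℚ.≤ size x × size x ℚ.≤ 1ℚ) xs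
  sizes = All.tabulate⁺ bounded
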